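{- Let $G=(V,E)$ be a finite simple directed graph with transitive closure $G^*$. If $O$ is a transitive orientation of the undirected complement $\overline{\mathcal{U}(G)}$, then the restriction of $O$ to the edges of $\overline{\mathcal{U}(G^*)}$ is a transitive orientation of $\overline{\mathcal{U}(G^*)}$.
   Context: Graphs are simple and directed; an undirected graph has $E=E^{ -1}$ where $E^{ -1}=\{(b,a)\mid(a,b)\in E\}$. $\mathcal{U}(G)=(V,E\cup E^{ -1})$; the complement of $(V,F)$ is $(V,\{(a,b):a\neq b\}\setminus F)$; $\overline{\mathcal{U}(G)}$ is the complement of $\mathcal{U}(G)$. $G^*=(V,E^*)$ with $E^*$ the minimal transitive superset of $E$, where a graph is transitive iff $(a,b),(b,c)\in E$, $a\neq c$ imply $(a,c)\in E$. Note $\overline{\mathcal{U}(G^*)}$ is a subgraph of $\overline{\mathcal{U}(G)}$. A graph is oriented if $E\cap E^{ -1}=\emptyset$; an orientation of $(V,E)$ is $(V,E')$ with $E'$ a maximal oriented subset of $E$; a transitive orientation is an orientation that is transitive. -}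

module Defs where

open import Data.Nat using (ℕ)
open import Data.Fin using (Fin)
open import Data.Product using (_×_; Σ; _,_)
open import Data.Empty using (⊥)
open import Relation.Nullary using (¬_)
open import Relation.Binary.PropositionalEquality using (_≡_)

-- A (directed) graph on the finite vertex set Fin n is given by its edge relation.
Rel : ℕ → Set₁
Rel n = Fin n → Fin n → Set

Simple : ∀ {n} → Rel n → Set
Simple E = ∀ a → ¬ E a a

_⊆_ : ∀ {n} → Rel n → Rel n → Set
E ⊆ F = ∀ a b → E a b → F a b

inv : ∀ {n} → Rel n → Rel n
inv E a b = E b a

-- Intersection of edge sets (restriction of one graph to edges of another).
_∩_ : ∀ {n} → Rel n → Rel n → Rel n
(E ∩ F) a b = E a b × F a b

U : ∀ {n} → Rel n → Rel n
U E a b = Data.Sum._⊎_ (E a b) (E b a)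
  where import Data.Sum

compl : ∀ {n} → Rel n → Rel n
compl F a b = ¬ (a ≡ b) × ¬ F a b

Transitive : ∀ {n} → Rel n → Set
Transitive E = ∀ a b c → E a b → E b c → ¬ (a ≡ c) → E a c

-- E^*: minimal transitive superset of E, as an inductive relation
data Closure {n : ℕ} (E : Rel n) : Rel n where
  base : ∀ {a b} → E a b → Closure E a b
  step : ∀ {a b c} → Closure E a b → Closure E b c → ¬ (a ≡ c) → Closure E a c

Oriented : ∀ {n} → Rel n → Set
Oriented E = ∀ a b → E a b → E b a → ⊥

IsOrientation : ∀ {n} → Rel n → Rel n → Set₁
IsOrientation {n} O E =
  O ⊆ E × Oriented O ×
  ((F : Rel n) → O ⊆ F → F ⊆ E → Oriented F → F ⊆ O)

IsTransitiveOrientation : ∀ {n} → Rel n → Rel n → Set₁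
IsTransitiveOrientation O E = IsOrientation O E × Transitive O

module Submission where

-- Restricting to a symmetric sub-relation preserves maximality, since a maximal orientation
-- contains every edge in at least one direction. For transitivity, suppose O a b and O b c
-- are edges of the complement of U(G*) but a →* c in G. Walking along the path from a, each
-- vertex v keeps O v b: the next vertex w is not adjacent to b in U(G) (that would put b on a
-- path a →* b or b →* c), and O b w would give O v w by transitivity although (v, w) ∈ E.
-- So O c b, contradicting O b c. The case c →* a is the same argument applied to O⁻¹.

open import Data.Nat using (ℕ)
open import Data.Fin.Properties using (_≟_)
open import Data.Product using (_×_; _,_; proj₁; proj₂)
open import Data.Sum using (_⊎_; inj₁; inj₂; [_,_])
open import Function using (_∘_)
open import Relation.Nullary using (¬_; yes; no)
open import Relation.Binary.Definitions using (Symmetric)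
open import Relation.Binary.PropositionalEquality using (_≡_; _≢_; refl; sym)
open import Defs

Covers : ∀ {n} → Rel n → Rel n → Set
Covers O C = ∀ {a b} → C a b → ¬ O b a → O a b

compl-simple : ∀ {n} (R : Rel n) → Simple (compl R)
compl-simple R a (a≢a , _) = a≢a refl

compl-U-sym : ∀ {n} (R : Rel n) → Symmetric (compl (U R))
compl-U-sym R (a≢b , ¬Uab) = a≢b ∘ sym , ¬Uab ∘ [ inj₂ , inj₁ ]

compl-U-antitone : ∀ {n} {R S : Rel n} → R ⊆ S → compl (U S) ⊆ compl (U R)
compl-U-antitone R⊆S a b (a≢b , ¬Uab) =
  a≢b , ¬Uab ∘ [ inj₁ ∘ R⊆S a b , inj₂ ∘ R⊆S b a ]

closure-trans-or-≡ : ∀ {n} {E : Rel n} {u v w} →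
  Closure E u v → Closure E v w → u ≡ w ⊎ Closure E u w
closure-trans-or-≡ {u = u} {w = w} u⇝v v⇝w with u ≟ w
... | yes u≡w = inj₁ u≡w
... | no u≢w = inj₂ (step u⇝v v⇝w u≢w)

orientation-covers : ∀ {n} {O C : Rel n} → Simple C → IsOrientation O C → Covers O C
orientation-covers {n} {O} {C} C-simple (O⊆C , O-oriented , maximal) {a} {b} Cab ¬Oba =
  maximal O+ (λ _ _ → inj₁) O+⊆C O+-oriented a b (inj₂ (refl , refl))
  where
  O+ : Rel n
  O+ u v = O u v ⊎ (u ≡ a × v ≡ b)

  O+⊆C : O+ ⊆ C
  O+⊆C u v (inj₁ Ouv) = O⊆C u v Ouv
  O+⊆C u v (inj₂ (refl , refl)) = Cab

  O+-oriented : Oriented O+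
  O+-oriented u v (inj₁ Ouv) (inj₁ Ovu) = O-oriented u v Ouv Ovu
  O+-oriented u v (inj₁ Oba) (inj₂ (refl , refl)) = ¬Oba Oba
  O+-oriented u v (inj₂ (refl , refl)) (inj₁ Oba) = ¬Oba Oba
  O+-oriented u v (inj₂ (refl , refl)) (inj₂ (refl , _)) = C-simple u Cab

restrict-orientation : ∀ {n} {O C D : Rel n} → Simple C → Symmetric D → D ⊆ C →
  IsOrientation O C → IsOrientation (O ∩ D) D
restrict-orientation {n} {O} {D = D} C-simple D-sym D⊆C isOrientation@(_ , O-oriented , _) =
  (λ _ _ → proj₂) , (λ a b O∩Dab O∩Dba → O-oriented a b (proj₁ O∩Dab) (proj₁ O∩Dba)) , maximal
  where
  maximal : (F : Rel n) → (O ∩ D) ⊆ F → F ⊆ D → Oriented F → F ⊆ (O ∩ D)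
  maximal F O∩D⊆F F⊆D F-oriented a b Fab =
    orientation-covers C-simple isOrientation (D⊆C a b Dab) ¬Oba , Dab
    where
    Dab : D a b
    Dab = F⊆D a b Fab

    ¬Oba : ¬ O b a
    ¬Oba Oba = F-oriented a b Fab (O∩D⊆F b a (Oba , D-sym Dab))

module Propagation {n} {E O : Rel n} (E-simple : Simple E) (O⊆ : O ⊆ compl (U E))
  (O-oriented : Oriented O) (O-trans : Transitive O) (O-covers : Covers O (compl (U E))) where

  orient-along-edge : ∀ {x y b} → E x y → O x b → ¬ E y b → ¬ E b y → y ≢ b → O y b
  orient-along-edge {x} {y} {b} Exy Oxb ¬Eyb ¬Eby y≢b = O-covers (y≢b , [ ¬Eyb , ¬Eby ]) ¬Oby
    where
    x≢y : x ≢ y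
    x≢y refl = E-simple x Exy

    ¬Oby : ¬ O b y
    ¬Oby Oby = proj₂ (O⊆ x y (O-trans x b y Oxb Oby x≢y)) (inj₁ Exy)

  orient-along-closure : ∀ {x y b} → Closure E x y → O x b →
    ¬ Closure E x b → b ≢ y → ¬ Closure E b y → O y b
  orient-along-closure {x} {y} {b} (base Exy) Oxb ¬x⇝b b≢y ¬b⇝y =
    orient-along-edge Exy Oxb
      (λ Eyb → ¬x⇝b (step (base Exy) (base Eyb) (proj₁ (O⊆ x b Oxb))))
      (¬b⇝y ∘ base) (b≢y ∘ sym)
  orient-along-closure {x} {y} {b} (step {b = m} x⇝m m⇝y _) Oxb ¬x⇝b b≢y ¬b⇝y =
    orient-along-closure m⇝y Omb (λ m⇝b → ¬x⇝b (step x⇝m m⇝b (proj₁ (O⊆ x b Oxb)))) b≢y ¬b⇝y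
    where
    b≢m : b ≢ m
    b≢m refl = ¬x⇝b x⇝m

    ¬b⇝m : ¬ Closure E b m
    ¬b⇝m b⇝m = [ b≢y , ¬b⇝y ] (closure-trans-or-≡ b⇝m m⇝y)

    Omb : O m b
    Omb = orient-along-closure x⇝m Oxb ¬x⇝b b≢m ¬b⇝m

  no-closure-across : ∀ {a b c} → O a b → O b c →
    ¬ Closure E a b → b ≢ c → ¬ Closure E b c → ¬ Closure E a c
  no-closure-across {b = b} {c} Oab Obc ¬a⇝b b≢c ¬b⇝c a⇝c =
    O-oriented b c Obc (orient-along-closure a⇝c Oab ¬a⇝b b≢c ¬b⇝c)

inv-⊆ : ∀ {n} {O C : Rel n} → Symmetric C → O ⊆ C → inv O ⊆ C
inv-⊆ C-sym O⊆C a b Oba = C-sym (O⊆C b a Oba)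

inv-oriented : ∀ {n} {O : Rel n} → Oriented O → Oriented (inv O)
inv-oriented O-oriented a b Oba Oab = O-oriented a b Oab Oba

inv-transitive : ∀ {n} {O : Rel n} → Transitive O → Transitive (inv O)
inv-transitive O-trans a b c Oba Ocb a≢c = O-trans c b a Ocb Oba (a≢c ∘ sym)

inv-covers : ∀ {n} {O C : Rel n} → Symmetric C → Covers O C → Covers (inv O) C
inv-covers C-sym O-covers Cab ¬Oab = O-covers (C-sym Cab) ¬Oab

transitive-restriction : ∀ {n} {E O : Rel n} → Simple E →
  IsTransitiveOrientation O (compl (U E)) → Transitive (O ∩ compl (U (Closure E)))
transitive-restriction {E = E} {O} E-simple (isOrientation@(O⊆ , O-oriented , _) , O-trans)
  a b c (Oab , a≢b , ¬Uab) (Obc , b≢c , ¬Ubc) a≢c =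
  O-trans a b c Oab Obc a≢c , a≢c , [ ¬a⇝c , ¬c⇝a ]
  where
  O-covers : Covers O (compl (U E))
  O-covers = orientation-covers (compl-simple (U E)) isOrientation

  module Forward = Propagation E-simple O⊆ O-oriented O-trans O-covers
  module Backward = Propagation E-simple (inv-⊆ {C = compl (U E)} (compl-U-sym E) O⊆)
    (inv-oriented O-oriented) (inv-transitive O-trans)
    (inv-covers {C = compl (U E)} (compl-U-sym E) O-covers)

  ¬a⇝c : ¬ Closure E a c
  ¬a⇝c = Forward.no-closure-across Oab Obc (¬Uab ∘ inj₁) b≢c (¬Ubc ∘ inj₁)

  ¬c⇝a : ¬ Closure E c a
  ¬c⇝a = Backward.no-closure-across Obc Oab (¬Ubc ∘ inj₂) (a≢b ∘ sym) (¬Uab ∘ inj₂)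

theorem4 : (n : ℕ) (E O : Rel n) → Simple E →
    IsTransitiveOrientation O (compl (U E)) →
    IsTransitiveOrientation (O ∩ compl (U (Closure E))) (compl (U (Closure E)))
theorem4 n E O E-simple (isOrientation , O-trans) =
  restrict-orientation (compl-simple (U E)) (compl-U-sym (Closure E))
    (compl-U-antitone (λ _ _ → base)) isOrientation ,
  transitive-restriction E-simple (isOrientation , O-trans)
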